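{- For every $k \in \mathbb{N}$, let $H_k$ be the graph obtained from $k$ disjoint paths $P^1,\dots,P^k$, each on three vertices, by choosing an end-vertex $v_i$ of each $P^i$ and adding all edges between the vertices $v_1,\dots,v_k$ (so these form a clique). Then $H_k$ is connected and $(P_7,C_7)$-free, and $\gamma_c(H_k)/\gamma(H_k) = 2$.
   Context: $\gamma(G)$ is the minimum size of a dominating set of $G$ (a set $X$ such that every vertex outside $X$ has a neighbor in $X$); $\gamma_c(G)$ is the minimum size of a dominating set inducing a connected subgraph. $P_k$, $C_k$ denote the path and cycle on $k$ vertices; $(P_7,C_7)$-free means no induced $P_7$ and no induced $C_7$. -}

module Defs where

open import Data.Nat using (ℕ; zero; suc; _*_; _∸_; _≤_)
open import Data.Fin using (Fin; toℕ; remQuot)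
open import Data.Fin.Subset using (Subset; _∈_; _∉_; ∣_∣; ⊤)
open import Data.Product using (Σ; ∃; _×_; _,_; proj₁; proj₂)
open import Data.Sum using (_⊎_; inj₁; inj₂)
open import Data.Empty using (⊥)
open import Relation.Nullary using (¬_)
open import Relation.Binary.PropositionalEquality using (_≡_; _≢_; refl; sym; cong)
open import Data.Nat using (pred)
open import Function.Definitions using (Injective)

record Graph (n : ℕ) : Set₁ where
  field
    Adj    : Fin n → Fin n → Set
    symm   : ∀ {u v} → Adj u v → Adj v u
    irrefl : ∀ {u} → ¬ Adj u u
open Graph public

module _ {n : ℕ} (G : Graph n) where

  Dominating : Subset n → Set
  Dominating X = ∀ v → v ∉ X → ∃ λ u → u ∈ X × Adj G u v

  data WalkIn (X : Subset n) : Fin n → Fin n → Set where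
    here : ∀ {u} → u ∈ X → WalkIn X u u
    step : ∀ {u w v} → u ∈ X → Adj G u w → WalkIn X w v → WalkIn X u v

  InducesConnected : Subset n → Set
  InducesConnected X = ∀ u v → u ∈ X → v ∈ X → WalkIn X u v

  Connected : Set
  Connected = InducesConnected ⊤

  ConnectedDominating : Subset n → Set
  ConnectedDominating X = Dominating X × InducesConnected X

  IsDominationNumber : ℕ → Set
  IsDominationNumber m =
    (∃ λ X → Dominating X × ∣ X ∣ ≡ m) × (∀ X → Dominating X → m ≤ ∣ X ∣)

  IsConnectedDominationNumber : ℕ → Set
  IsConnectedDominationNumber m =
    (∃ λ X → ConnectedDominating X × ∣ X ∣ ≡ m) × (∀ X → ConnectedDominating X → m ≤ ∣ X ∣)

  HasInduced : (m : ℕ) → (Fin m → Fin m → Set) → Set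
  HasInduced m A = Σ (Fin m → Fin n) λ f →
    Injective _≡_ _≡_ f × (∀ i j → (Adj G (f i) (f j) → A i j) × (A i j → Adj G (f i) (f j)))

PathAdj : {m : ℕ} → Fin m → Fin m → Set
PathAdj i j = toℕ j ≡ suc (toℕ i) ⊎ toℕ i ≡ suc (toℕ j)

CycleAdj : {m : ℕ} → Fin m → Fin m → Set
CycleAdj {m} i j = PathAdj i j ⊎ ((toℕ i ≡ 0 × toℕ j ≡ m ∸ 1) ⊎ (toℕ j ≡ 0 × toℕ i ≡ m ∸ 1))

P7C7Free : {n : ℕ} → Graph n → Set
P7C7Free G = ¬ HasInduced G 7 PathAdj × ¬ HasInduced G 7 CycleAdj

-- H_k. Vertex (i , a) ∈ Fin k × Fin 3 is the a-th vertex of the path P^i = (i,0)-(i,1)-(i,2);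
-- v_i = (i , 0) is the chosen end-vertex, and the v_i form a clique.
HAdj' : {k : ℕ} → Fin k × Fin 3 → Fin k × Fin 3 → Set
HAdj' (i , a) (j , b) = (i ≡ j × PathAdj a b) ⊎ (i ≢ j × (toℕ a ≡ 0 × toℕ b ≡ 0))

private
  noLoop : ∀ n → ¬ (n ≡ suc n)
  noLoop zero ()
  noLoop (suc n) e = noLoop n (cong pred e)

  pathSym : ∀ {m} {a b : Fin m} → PathAdj a b → PathAdj b a
  pathSym (inj₁ e) = inj₂ e
  pathSym (inj₂ e) = inj₁ e

  HAdj'-sym : ∀ {k} {x y : Fin k × Fin 3} → HAdj' x y → HAdj' y x
  HAdj'-sym (inj₁ (e , p)) = inj₁ (sym e , pathSym p)
  HAdj'-sym (inj₂ (ne , a , b)) = inj₂ ((λ e → ne (sym e)) , b , a)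

  HAdj'-irrefl : ∀ {k} {x : Fin k × Fin 3} → ¬ HAdj' x x
  HAdj'-irrefl (inj₁ (_ , inj₁ e)) = noLoop _ e
  HAdj'-irrefl (inj₁ (_ , inj₂ e)) = noLoop _ e
  HAdj'-irrefl (inj₂ (ne , _)) = ne refl

H : (k : ℕ) → Graph (k * 3)
H k = record
  { Adj    = λ u v → HAdj' (remQuot {k} 3 u) (remQuot {k} 3 v)
  ; symm   = HAdj'-sym
  ; irrefl = HAdj'-irrefl
  }

-- Call (i , 0) the hub, (i , 1) the middle and (i , 2) the leaf of the i-th path. In an induced P₇ or
-- C₇ the vertices 1, 3, 5 have two neighbours in the copy, so they are not leaves; then 2 and 4 have
-- two non-leaf neighbours, which forces them to be hubs, but distinct hubs are adjacent while 2 and 4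
-- are not. A dominating set must contain the middle or the leaf of every path, so γ ≥ k, and the
-- middles attain this. A connected dominating set must also contain every hub, since a walk from one
-- path to another leaves through the hub; so γ_c ≥ 2k, attained by the hubs together with the middles.

module Submission where

open import Defs
open import Data.Nat using (ℕ; zero; suc; _+_; _*_; _≤_; z≤n; s≤s)
open import Data.Nat.Properties using (≤-<-trans; +-mono-≤; *-comm; *-identityʳ; module ≤-Reasoning)
open import Data.Fin using (Fin; combine; remQuot; _↑ˡ_; _↑ʳ_; _≟_) renaming (zero to fzero; suc to fsuc)
open import Data.Fin.Patterns using (0F; 1F; 2F; 3F; 4F; 5F; 6F)
open import Data.Fin.Properties using (toℕ-injective; remQuot-combine; *↔×)
open import Data.Fin.Subset using (Subset; _∈_; ∣_∣; ⊤; inside; outside; ⁅_⁆)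
open import Data.Fin.Subset.Properties using (_∈?_; ∈⊤; x∈⁅x⁆; x∈p⇒∣p-x∣<∣p∣; x∈p∧x≢y⇒x∈p-y)
open import Data.Vec using ([]; _∷_; _++_; take; drop; concat; replicate; here; there)
open import Data.Vec.Properties using (take++drop≡id)
open import Data.Product using (∃; _×_; _,_; proj₁; proj₂; uncurry)
open import Data.Sum using (_⊎_; inj₁; inj₂; [_,_]′; map)
open import Function using (_∘_)
open import Function.Bundles using (Injection)
open import Function.Properties.Inverse using (↔⇒↣)
open import Relation.Nullary using (¬_; yes; no; contradiction)
open import Relation.Binary.PropositionalEquality using (_≡_; _≢_; refl; sym; trans; cong; cong₂; subst; subst₂)

∣p++q∣≡∣p∣+∣q∣ : ∀ {m n} (p : Subset m) (q : Subset n) → ∣ p ++ q ∣ ≡ ∣ p ∣ + ∣ q ∣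
∣p++q∣≡∣p∣+∣q∣ []            q = refl
∣p++q∣≡∣p∣+∣q∣ (inside  ∷ p) q = cong suc (∣p++q∣≡∣p∣+∣q∣ p q)
∣p++q∣≡∣p∣+∣q∣ (outside ∷ p) q = ∣p++q∣≡∣p∣+∣q∣ p q

∈-++⁺ˡ : ∀ {m n} {x : Fin m} {p : Subset m} (q : Subset n) → x ∈ p → x ↑ˡ n ∈ p ++ q
∈-++⁺ˡ q here      = here
∈-++⁺ˡ q (there x∈p) = there (∈-++⁺ˡ q x∈p)

∈-++⁺ʳ : ∀ {m n} {x : Fin n} (p : Subset m) {q : Subset n} → x ∈ q → m ↑ʳ x ∈ p ++ q
∈-++⁺ʳ []      x∈q = x∈q
∈-++⁺ʳ (_ ∷ p) x∈q = there (∈-++⁺ʳ p x∈q)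

∈-++⁻ˡ : ∀ {m n} {x : Fin m} (p : Subset m) {q : Subset n} → x ↑ˡ n ∈ p ++ q → x ∈ p
∈-++⁻ˡ {x = fzero}  (inside ∷ p) here      = here
∈-++⁻ˡ {x = fsuc x} (_ ∷ p)      (there h) = there (∈-++⁻ˡ p h)

∈-++⁻ʳ : ∀ {m n} {x : Fin n} (p : Subset m) {q : Subset n} → m ↑ʳ x ∈ p ++ q → x ∈ q
∈-++⁻ʳ []      h         = h
∈-++⁻ʳ (_ ∷ p) (there h) = ∈-++⁻ʳ p h

-- the elements a with combine i a ∈ p
block : ∀ {k n} → Fin k → Subset (k * n) → Subset n
block {suc k} {n} fzero    p = take n p
block {suc k} {n} (fsuc i) p = block i (drop n p)

combine∈⇒∈block : ∀ {k n} (i : Fin k) {a : Fin n} {p : Subset (k * n)} →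
                  combine i a ∈ p → a ∈ block {k} {n} i p
combine∈⇒∈block {suc k} {n} fzero {p = p} h =
  ∈-++⁻ˡ (take n p) (subst (_ ∈_) (sym (take++drop≡id n p)) h)
combine∈⇒∈block {suc k} {n} (fsuc i) {p = p} h =
  combine∈⇒∈block i (∈-++⁻ʳ (take n p) (subst (_ ∈_) (sym (take++drop≡id n p)) h))

m≤∣block∣⇒k*m≤∣p∣ : ∀ k {n} m (p : Subset (k * n)) → (∀ i → m ≤ ∣ block {k} {n} i p ∣) → k * m ≤ ∣ p ∣
m≤∣block∣⇒k*m≤∣p∣ zero        m p h = z≤n
m≤∣block∣⇒k*m≤∣p∣ (suc k) {n} m p h = begin
  m + k * m                    ≤⟨ +-mono-≤ (h fzero) (m≤∣block∣⇒k*m≤∣p∣ k m (drop n p) (h ∘ fsuc)) ⟩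
  ∣ take n p ∣ + ∣ drop n p ∣  ≡⟨ sym (∣p++q∣≡∣p∣+∣q∣ (take n p) (drop n p)) ⟩
  ∣ take n p ++ drop n p ∣     ≡⟨ cong ∣_∣ (take++drop≡id n p) ⟩
  ∣ p ∣                        ∎
  where open ≤-Reasoning

tile : ∀ k {n} → Subset n → Subset (k * n)
tile k p = concat (replicate k p)

∣tile∣≡k*∣p∣ : ∀ k {n} (p : Subset n) → ∣ tile k p ∣ ≡ k * ∣ p ∣
∣tile∣≡k*∣p∣ zero    p = refl
∣tile∣≡k*∣p∣ (suc k) p = trans (∣p++q∣≡∣p∣+∣q∣ p (tile k p)) (cong (∣ p ∣ +_) (∣tile∣≡k*∣p∣ k p))

x∈p⇒combine∈tile : ∀ {k n} (i : Fin k) {x : Fin n} {p : Subset n} → x ∈ p → combine i x ∈ tile k p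
x∈p⇒combine∈tile {suc k} fzero    {p = p} x∈p = ∈-++⁺ˡ (tile k p) x∈p
x∈p⇒combine∈tile {suc k} (fsuc i) {p = p} x∈p = ∈-++⁺ʳ p (x∈p⇒combine∈tile i x∈p)

x∈p⇒1≤∣p∣ : ∀ {n} {x : Fin n} {p : Subset n} → x ∈ p → 1 ≤ ∣ p ∣
x∈p⇒1≤∣p∣ x∈p = ≤-<-trans z≤n (x∈p⇒∣p-x∣<∣p∣ x∈p)

x,y∈p⇒2≤∣p∣ : ∀ {n} {x y : Fin n} {p : Subset n} → x ∈ p → y ∈ p → x ≢ y → 2 ≤ ∣ p ∣
x,y∈p⇒2≤∣p∣ x∈p y∈p x≢y = ≤-<-trans (x∈p⇒1≤∣p∣ (x∈p∧x≢y⇒x∈p-y x∈p x≢y)) (x∈p⇒∣p-x∣<∣p∣ y∈p)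

2≤n⇒∃≢ : ∀ {n} → 2 ≤ n → (i : Fin n) → ∃ λ j → j ≢ i
2≤n⇒∃≢ (s≤s (s≤s _)) fzero    = 1F , λ ()
2≤n⇒∃≢ (s≤s (s≤s _)) (fsuc i) = fzero , λ ()

module _ {n} {G : Graph n} {X : Subset n} where

  _▸_ : ∀ {u v w} → WalkIn G X u v → WalkIn G X v w → WalkIn G X u w
  here _             ▸ q = q
  step u∈X u~w w⇝v ▸ q = step u∈X u~w (w⇝v ▸ q)

  walk-start∈ : ∀ {u v} → WalkIn G X u v → u ∈ X
  walk-start∈ (here u∈X)     = u∈X
  walk-start∈ (step u∈X _ _) = u∈X

  reverse : ∀ {u v} → WalkIn G X u v → WalkIn G X v u
  reverse (here u∈X)           = here u∈X
  reverse (step u∈X u~w w⇝v) = reverse w⇝v ▸ step (walk-start∈ w⇝v) (symm G u~w) (here u∈X)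

pathAdj-2⇒1 : ∀ {b : Fin 3} → PathAdj 2F b → b ≡ 1F
pathAdj-2⇒1 {1F} (inj₂ refl) = refl
pathAdj-2⇒1 {0F} (inj₁ ())
pathAdj-2⇒1 {0F} (inj₂ ())
pathAdj-2⇒1 {1F} (inj₁ ())
pathAdj-2⇒1 {2F} (inj₁ ())
pathAdj-2⇒1 {2F} (inj₂ ())

pathAdj-1⇒0⊎2 : ∀ {b : Fin 3} → PathAdj 1F b → b ≡ 0F ⊎ b ≡ 2F
pathAdj-1⇒0⊎2 {0F} _           = inj₁ refl
pathAdj-1⇒0⊎2 {2F} _           = inj₂ refl
pathAdj-1⇒0⊎2 {1F} (inj₁ ())
pathAdj-1⇒0⊎2 {1F} (inj₂ ())

module _ {k : ℕ} where

  leaf-neighbour : ∀ {i : Fin k} {y} → HAdj' (i , 2F) y → y ≡ (i , 1F)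
  leaf-neighbour (inj₁ (refl , 2~b)) = cong (_ ,_) (pathAdj-2⇒1 2~b)
  leaf-neighbour (inj₂ (_ , () , _))

  middle-neighbour : ∀ {i : Fin k} {y} → HAdj' (i , 1F) y → y ≡ (i , 0F) ⊎ y ≡ (i , 2F)
  middle-neighbour (inj₁ (refl , 1~b)) = map (cong (_ ,_)) (cong (_ ,_)) (pathAdj-1⇒0⊎2 1~b)
  middle-neighbour (inj₂ (_ , () , _))

  non-hub-neighbour-on-path : ∀ {i : Fin k} {a y} → a ≢ 0F → HAdj' (i , a) y → proj₁ y ≡ i
  non-hub-neighbour-on-path a≢0 (inj₁ (refl , _))     = refl
  non-hub-neighbour-on-path a≢0 (inj₂ (_ , a≡0 , _)) = contradiction (toℕ-injective a≡0) a≢0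

  hubs-adjacent : ∀ {x y : Fin k × Fin 3} → proj₂ x ≡ 0F → proj₂ y ≡ 0F → x ≢ y → HAdj' x y
  hubs-adjacent {i , 0F} {j , 0F} refl refl x≢y = inj₂ (x≢y ∘ cong (_, 0F) , refl , refl)

  two-neighbours⇒not-leaf : ∀ {x y z : Fin k × Fin 3} →
                            HAdj' x y → HAdj' x z → y ≢ z → proj₂ x ≢ 2F
  two-neighbours⇒not-leaf {i , 2F} x~y x~z y≢z refl =
    y≢z (trans (leaf-neighbour x~y) (sym (leaf-neighbour x~z)))

  two-inner-neighbours⇒hub : ∀ {x y z : Fin k × Fin 3} → HAdj' x y → HAdj' x z → y ≢ z →
                             proj₂ y ≢ 2F → proj₂ z ≢ 2F → proj₂ x ≡ 0F
  two-inner-neighbours⇒hub {i , 0F} _ _ _ _ _ = refl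
  two-inner-neighbours⇒hub {i , 1F} x~y x~z y≢z y≢2 z≢2
    with middle-neighbour x~y | middle-neighbour x~z
  ... | inj₁ refl | inj₁ refl = contradiction refl y≢z
  ... | inj₂ refl | _         = contradiction refl y≢2
  ... | _         | inj₂ refl = contradiction refl z≢2
  two-inner-neighbours⇒hub {i , 2F} x~y x~z y≢z _ _ =
    contradiction refl (two-neighbours⇒not-leaf x~y x~z y≢z)

module _ {k : ℕ} where

  remQuot-injective : ∀ {u v : Fin (k * 3)} → remQuot {k} 3 u ≡ remQuot 3 v → u ≡ v
  remQuot-injective = Injection.injective (↔⇒↣ (*↔× {k} {3}))

  remQuot≡⇒≡combine : ∀ {u : Fin (k * 3)} {i a} → remQuot {k} 3 u ≡ (i , a) → u ≡ combine i a
  remQuot≡⇒≡combine {i = i} {a} e =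
    remQuot-injective (trans e (sym (remQuot-combine i a)))

  Adj-combine : ∀ {i j a b} → HAdj' (i , a) (j , b) → Adj (H k) (combine i a) (combine j b)
  Adj-combine {i} {j} {a} {b} = subst₂ HAdj' (sym (remQuot-combine i a)) (sym (remQuot-combine j b))

  ∀-combine : (Q : Fin (k * 3) → Set) → (∀ i a → Q (combine i a)) → ∀ v → Q v
  ∀-combine Q h v = subst Q (sym (remQuot≡⇒≡combine {v} refl)) (uncurry h (remQuot {k} 3 v))

  no-induced-P₇-supergraph-with-2≁4 : (A : Fin 7 → Fin 7 → Set) → (∀ p q → PathAdj p q → A p q) →
                                     ¬ A 2F 4F → ¬ HasInduced (H k) 7 A
  no-induced-P₇-supergraph-with-2≁4 A path⊆A 2≁4 (f , f-injective , f-induced) =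
    2≁4 (proj₁ (f-induced 2F 4F) (hubs-adjacent hub₂ hub₄ (distinct 2F 4F λ ())))
    where
    g : Fin 7 → Fin k × Fin 3
    g = remQuot 3 ∘ f

    distinct : ∀ p q → p ≢ q → g p ≢ g q
    distinct p q p≢q = p≢q ∘ f-injective ∘ remQuot-injective

    edge : ∀ {p q} → PathAdj p q → HAdj' (g p) (g q)
    edge {p} {q} p~q = proj₂ (f-induced p q) (path⊆A p q p~q)

    not-leaf : ∀ p q r → PathAdj p q → PathAdj p r → q ≢ r → proj₂ (g p) ≢ 2F
    not-leaf p q r p~q p~r q≢r = two-neighbours⇒not-leaf (edge p~q) (edge p~r) (distinct q r q≢r)

    hub : ∀ p q r → PathAdj p q → PathAdj p r → q ≢ r →
          proj₂ (g q) ≢ 2F → proj₂ (g r) ≢ 2F → proj₂ (g p) ≡ 0F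
    hub p q r p~q p~r q≢r = two-inner-neighbours⇒hub (edge p~q) (edge p~r) (distinct q r q≢r)

    not-leaf₁ : proj₂ (g 1F) ≢ 2F
    not-leaf₃ : proj₂ (g 3F) ≢ 2F
    not-leaf₅ : proj₂ (g 5F) ≢ 2F
    hub₂ : proj₂ (g 2F) ≡ 0F
    hub₄ : proj₂ (g 4F) ≡ 0F
    not-leaf₁ = not-leaf 1F 0F 2F (inj₂ refl) (inj₁ refl) λ ()
    not-leaf₃ = not-leaf 3F 2F 4F (inj₂ refl) (inj₁ refl) λ ()
    not-leaf₅ = not-leaf 5F 4F 6F (inj₂ refl) (inj₁ refl) λ ()
    hub₂ = hub 2F 1F 3F (inj₂ refl) (inj₁ refl) (λ ()) not-leaf₁ not-leaf₃
    hub₄ = hub 4F 3F 5F (inj₂ refl) (inj₁ refl) (λ ()) not-leaf₃ not-leaf₅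

  module _ (X : Subset (k * 3)) where

    dominating⇒meets-tail : Dominating (H k) X → ∀ i → combine i 1F ∈ X ⊎ combine i 2F ∈ X
    dominating⇒meets-tail dom i with combine i 2F ∈? X
    ... | yes 2∈X = inj₂ 2∈X
    ... | no 2∉X = inj₁ (leaf-dominator∈ (dom (combine i 2F) 2∉X))
      where
      leaf-dominator∈ : (∃ λ u → u ∈ X × Adj (H k) u (combine i 2F)) → combine i 1F ∈ X
      leaf-dominator∈ (u , u∈X , u~2) = subst (_∈ X) (remQuot≡⇒≡combine (leaf-neighbour 2~u)) u∈X
        where
        2~u : HAdj' (i , 2F) (remQuot 3 u)
        2~u = subst (λ x → HAdj' x (remQuot 3 u)) (remQuot-combine i 2F) (symm (H k) u~2)

    walk-leaving-path⇒hub∈ : ∀ {i u v} → WalkIn (H k) X u v →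
                             proj₁ (remQuot {k} 3 u) ≡ i → proj₁ (remQuot {k} 3 v) ≢ i → combine i 0F ∈ X
    walk-leaving-path⇒hub∈ (here _) u∈i v∉i = contradiction u∈i v∉i
    walk-leaving-path⇒hub∈ (step {u} u∈X u~w w⇝v) u∈i v∉i with proj₂ (remQuot {k} 3 u) ≟ 0F
    ... | yes u-hub = subst (_∈ X) (remQuot≡⇒≡combine (cong₂ _,_ u∈i u-hub)) u∈X
    ... | no u-not-hub =
      walk-leaving-path⇒hub∈ w⇝v (trans (non-hub-neighbour-on-path u-not-hub u~w) u∈i) v∉i

    middles⇒dominating : (∀ i → combine i 1F ∈ X) → Dominating (H k) X
    middles⇒dominating mid = ∀-combine _ λ where
      i 0F _    → combine i 1F , mid i , Adj-combine (inj₁ (refl , inj₂ refl))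
      i 1F 1∉X → contradiction (mid i) 1∉X
      i 2F _    → combine i 1F , mid i , Adj-combine (inj₁ (refl , inj₁ refl))

    hubs∧middles⇒connected : (∀ i → combine i 0F ∈ X) → (∀ i → combine i 1F ∈ X) →
                             InducesConnected (H k) X
    hubs∧middles⇒connected hub mid = ∀-combine _ λ i a → ∀-combine _ λ j b u∈X v∈X →
      to-hub i a u∈X ▸ (hub-to-hub i j ▸ reverse (to-hub j b v∈X))
      where
      to-hub : ∀ i a → combine i a ∈ X → WalkIn (H k) X (combine i a) (combine i 0F)
      to-hub i 0F u∈X = here u∈X
      to-hub i 1F u∈X = step u∈X (Adj-combine (inj₁ (refl , inj₂ refl))) (here (hub i))
      to-hub i 2F u∈X = step u∈X (Adj-combine (inj₁ (refl , inj₂ refl))) (to-hub i 1F (mid i))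

      hub-to-hub : ∀ i j → WalkIn (H k) X (combine i 0F) (combine j 0F)
      hub-to-hub i j with i ≟ j
      ... | yes refl = here (hub i)
      ... | no i≢j   = step (hub i) (Adj-combine (inj₂ (i≢j , refl , refl))) (here (hub j))

    dominating⇒path-member : Dominating (H k) X → ∀ i → ∃ λ u → u ∈ X × proj₁ (remQuot {k} 3 u) ≡ i
    dominating⇒path-member dom i = [ member 1F , member 2F ]′ (dominating⇒meets-tail dom i)
      where
      member : ∀ a → combine i a ∈ X → ∃ λ u → u ∈ X × proj₁ (remQuot {k} 3 u) ≡ i
      member a m = combine i a , m , cong proj₁ (remQuot-combine i a)

    connected-dominating⇒hubs : 2 ≤ k → ConnectedDominating (H k) X → ∀ i → combine i 0F ∈ X
    connected-dominating⇒hubs 2≤k (dom , conn) i with 2≤n⇒∃≢ 2≤k i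
    ... | j , j≢i with dominating⇒path-member dom i | dominating⇒path-member dom j
    ... | u , u∈X , u∈i | v , v∈X , v∈j =
      walk-leaving-path⇒hub∈ (conn u v u∈X v∈X) u∈i (j≢i ∘ trans (sym v∈j))

    dominating⇒1≤∣block∣ : Dominating (H k) X → ∀ i → 1 ≤ ∣ block {k} {3} i X ∣
    dominating⇒1≤∣block∣ dom i =
      [ x∈p⇒1≤∣p∣ ∘ combine∈⇒∈block i , x∈p⇒1≤∣p∣ ∘ combine∈⇒∈block i ]′ (dominating⇒meets-tail dom i)

    connected-dominating⇒2≤∣block∣ : 2 ≤ k → ConnectedDominating (H k) X → ∀ i → 2 ≤ ∣ block {k} {3} i X ∣
    connected-dominating⇒2≤∣block∣ 2≤k cd i =
      [ hub-and 1F (λ ()) , hub-and 2F (λ ()) ]′ (dominating⇒meets-tail (proj₁ cd) i)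
      where
      hub-and : ∀ a → 0F ≢ a → combine i a ∈ X → 2 ≤ ∣ block {k} {3} i X ∣
      hub-and a 0≢a a∈X = x,y∈p⇒2≤∣p∣ (combine∈⇒∈block i (connected-dominating⇒hubs 2≤k cd i))
                                       (combine∈⇒∈block i a∈X) 0≢a

    dominating⇒k≤∣X∣ : Dominating (H k) X → k ≤ ∣ X ∣
    dominating⇒k≤∣X∣ dom =
      subst (_≤ ∣ X ∣) (*-identityʳ k) (m≤∣block∣⇒k*m≤∣p∣ k 1 X (dominating⇒1≤∣block∣ dom))

    connected-dominating⇒2k≤∣X∣ : 2 ≤ k → ConnectedDominating (H k) X → 2 * k ≤ ∣ X ∣
    connected-dominating⇒2k≤∣X∣ 2≤k cd =
      subst (_≤ ∣ X ∣) (*-comm k 2) (m≤∣block∣⇒k*m≤∣p∣ k 2 X (connected-dominating⇒2≤∣block∣ 2≤k cd))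

  middles : Subset (k * 3)
  middles = tile k ⁅ 1F ⁆

  hubs-and-middles : Subset (k * 3)
  hubs-and-middles = tile k (inside ∷ inside ∷ outside ∷ [])

  middles-dominating : Dominating (H k) middles × ∣ middles ∣ ≡ k
  middles-dominating =
      middles⇒dominating middles (λ i → x∈p⇒combine∈tile i (x∈⁅x⁆ 1F))
    , trans (∣tile∣≡k*∣p∣ k ⁅ 1F ⁆) (*-identityʳ k)

  hubs-and-middles-connected-dominating :
    ConnectedDominating (H k) hubs-and-middles × ∣ hubs-and-middles ∣ ≡ 2 * k
  hubs-and-middles-connected-dominating =
      ( middles⇒dominating hubs-and-middles middle∈
      , hubs∧middles⇒connected hubs-and-middles (λ i → x∈p⇒combine∈tile i here) middle∈ )
    , trans (∣tile∣≡k*∣p∣ k _) (*-comm k 2)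
    where
    middle∈ : ∀ i → combine i 1F ∈ hubs-and-middles
    middle∈ i = x∈p⇒combine∈tile i (there here)

mainTheorem5 : ∀ (k : ℕ) → 2 ≤ k →
    Connected (H k) × P7C7Free (H k) ×
    (∃ λ g → IsDominationNumber (H k) g × IsConnectedDominationNumber (H k) (2 * g))
mainTheorem5 k 2≤k =
    hubs∧middles⇒connected ⊤ (λ _ → ∈⊤) (λ _ → ∈⊤)
  , ( no-induced-P₇-supergraph-with-2≁4 PathAdj (λ _ _ p~q → p~q) (λ { (inj₁ ()) ; (inj₂ ()) })
    , no-induced-P₇-supergraph-with-2≁4 CycleAdj (λ _ _ → inj₁)
        (λ { (inj₁ (inj₁ ())) ; (inj₁ (inj₂ ())) ; (inj₂ (inj₁ (() , _))) ; (inj₂ (inj₂ (() , _))) }) )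
  , k
  , ((middles {k} , middles-dominating) , dominating⇒k≤∣X∣)
  , ((hubs-and-middles {k} , hubs-and-middles-connected-dominating) , λ X → connected-dominating⇒2k≤∣X∣ X 2≤k)
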